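{- Let $X,Y$ be topological spaces and suppose $U\subseteq X\times Y$ is an open set which is universal for the open subsets of $Y$, i.e., for every open $W\subseteq Y$ there exists $x\in X$ with $U_x=W$. If $X$ is second countable, then so is $Y$.
   Context: $U_x=\{y\in Y:(x,y)\in U\}$. -}

module Defs where

open import Level using (0ℓ)
open import Data.Nat using (ℕ)
open import Data.Product using (Σ; _×_; _,_; ∃; ∃-syntax)
open import Relation.Unary using (Pred; _∈_; _⊆_; _∩_; _≐_; ⋃; U; _⟨×⟩_)

record TopSpace : Set₁ where
  field
    Carrier : Set
    Open    : Pred Carrier 0ℓ → Set
    open-U  : Open U
    open-∩  : ∀ {A B} → Open A → Open B → Open (A ∩ B)
    open-⋃  : ∀ (I : Set) (F : I → Pred Carrier 0ℓ) →
              (∀ i → Open (F i)) → Open (⋃ I F)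
    open-≐  : ∀ {A B} → A ≐ B → Open A → Open B

open TopSpace public

ProdOpen : (X Y : TopSpace) → Pred (Carrier X × Carrier Y) 0ℓ → Set₁
ProdOpen X Y W =
  ∀ p → p ∈ W →
  Σ (Pred (Carrier X) 0ℓ) λ A → Σ (Pred (Carrier Y) 0ℓ) λ V →
    Open X A × Open Y V × p ∈ (A ⟨×⟩ V) × (A ⟨×⟩ V) ⊆ W

section : {X Y : Set} → Pred (X × Y) 0ℓ → X → Pred Y 0ℓ
section U x = λ y → (x , y) ∈ U

IsUniversal : (X Y : TopSpace) → Pred (Carrier X × Carrier Y) 0ℓ → Set₁
IsUniversal X Y U = ∀ (W : Pred (Carrier Y) 0ℓ) → Open Y W →
  ∃[ x ] section U x ≐ W

-- A (countable) base indexed by ℕ (repetitions allowed, so this covers finite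
-- bases too; the empty set is open, so it can be used as padding).
IsBase : (X : TopSpace) → (ℕ → Pred (Carrier X) 0ℓ) → Set₁
IsBase X B = (∀ n → Open X (B n)) ×
  (∀ (W : Pred (Carrier X) 0ℓ) → Open X W → ∀ y → y ∈ W →
     ∃[ n ] (y ∈ B n × B n ⊆ W))

SecondCountable : TopSpace → Set₁
SecondCountable X = Σ (ℕ → Pred (Carrier X) 0ℓ) λ B → IsBase X B

module Submission where

-- Openness of U chooses, around each point p ∈ U, an open rectangle
-- A × V ⊆ U.  For a subset S ⊆ X the slice of U over S is the union of the
-- sides V of those chosen rectangles whose side A contains S.
-- The slices Cₙ of U over the basic sets Bₙ form a base of Y: given an open
-- W ∋ y, universality yields x with U_x = W; the rectangle A × V at (x , y)
-- and a basic Bₙ with x ∈ Bₙ ⊆ A give y ∈ Cₙ ⊆ U_x = W.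

open import Defs
open import Level using (0ℓ)
open import Data.Nat using (ℕ)
open import Data.Product using (_×_; Σ; _,_; proj₁; proj₂)
open import Relation.Unary using (Pred; _∈_; _⊆_; ⋃; _⟨×⟩_)

module Slice (X Y : TopSpace) (W : Pred (Carrier X × Carrier Y) 0ℓ)
             (W-open : ProdOpen X Y W) where

  rectX : ∀ p → p ∈ W → Pred (Carrier X) 0ℓ
  rectX p h = proj₁ (W-open p h)

  rectY : ∀ p → p ∈ W → Pred (Carrier Y) 0ℓ
  rectY p h = proj₁ (proj₂ (W-open p h))

  rectX-open : ∀ p (h : p ∈ W) → Open X (rectX p h)
  rectX-open p h = proj₁ (proj₂ (proj₂ (W-open p h)))

  rectY-open : ∀ p (h : p ∈ W) → Open Y (rectY p h)
  rectY-open p h = proj₁ (proj₂ (proj₂ (proj₂ (W-open p h))))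

  rect-∋ : ∀ p (h : p ∈ W) → p ∈ (rectX p h ⟨×⟩ rectY p h)
  rect-∋ p h = proj₁ (proj₂ (proj₂ (proj₂ (proj₂ (W-open p h)))))

  rect-⊆ : ∀ p (h : p ∈ W) → (rectX p h ⟨×⟩ rectY p h) ⊆ W
  rect-⊆ p h = proj₂ (proj₂ (proj₂ (proj₂ (proj₂ (W-open p h)))))

  -- Points of W whose chosen rectangle has first side containing S.
  -- (Indexing by points rather than by open sets keeps the index in Set.)
  Anchor : Pred (Carrier X) 0ℓ → Set
  Anchor S = Σ (Carrier X × Carrier Y) λ p → Σ (p ∈ W) λ h → S ⊆ rectX p h

  slice : Pred (Carrier X) 0ℓ → Pred (Carrier Y) 0ℓ
  slice S = ⋃ (Anchor S) λ { (p , h , _) → rectY p h }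

  slice-open : ∀ S → Open Y (slice S)
  slice-open S = open-⋃ Y (Anchor S) _ λ { (p , h , _) → rectY-open p h }

  slice-⊆-section : ∀ {S x} → x ∈ S → slice S ⊆ section W x
  slice-⊆-section x∈S ((p , h , S⊆A) , z∈V) = rect-⊆ p h (S⊆A x∈S , z∈V)

  slice-∋ : ∀ {S x y} (h : (x , y) ∈ W) → S ⊆ rectX (x , y) h → y ∈ slice S
  slice-∋ {x = x} {y} h S⊆A = ((x , y) , h , S⊆A) , proj₂ (rect-∋ (x , y) h)

proposition30 : (X Y : TopSpace) (U : Pred (Carrier X × Carrier Y) 0ℓ) →
    ProdOpen X Y U → IsUniversal X Y U → SecondCountable X → SecondCountable Y
proposition30 X Y U U-open universal (B , B-open , B-base) =
  C , (λ n → slice-open (B n)) , C-base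
  where
  open Slice X Y U U-open

  C : ℕ → Pred (Carrier Y) 0ℓ
  C n = slice (B n)

  C-base : ∀ W → Open Y W → ∀ y → y ∈ W → Σ ℕ λ n → (y ∈ C n × C n ⊆ W)
  C-base W W-open y y∈W with universal W W-open
  ... | x , Ux≐W = n , slice-∋ h Bn⊆A , λ z∈Cn → proj₁ Ux≐W (slice-⊆-section x∈Bn z∈Cn)
    where
    h : (x , y) ∈ U
    h = proj₂ Ux≐W y∈W

    basic : Σ ℕ λ n → (x ∈ B n × B n ⊆ rectX (x , y) h)
    basic = B-base _ (rectX-open (x , y) h) x (proj₁ (rect-∋ (x , y) h))

    n : ℕ
    n = proj₁ basic

    x∈Bn : x ∈ B n
    x∈Bn = proj₁ (proj₂ basic)

    Bn⊆A : B n ⊆ rectX (x , y) h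
    Bn⊆A = proj₂ (proj₂ basic)
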